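{- There exists a set $A\subseteq\mathbb{N}$ which is both additively thick and multiplicatively thick and contains no exponential triple, i.e. there are no $x,y\in A$ with $x\neq y$ and $x^y\in A$.
   Context: $A\subseteq\mathbb{N}$ is additively thick if for every finite $H\subseteq\mathbb{N}$ there is $x\in\mathbb{N}$ with $H+x=\{h+x:h\in H\}\subseteq A$, and multiplicatively thick if for every finite $H\subseteq\mathbb{N}$ there is $x\in\mathbb{N}$ with $Hx=\{hx:h\in H\}\subseteq A$. An exponential triple is a set $\{x,y,x^y\}$ with $x,y\in\mathbb{N}$, $x\neq y$. -}

module Defs where

open import Level using (0ℓ)
open import Data.Nat using (ℕ; _+_; _*_; _^_; _≥_)
open import Data.List using (List)
open import Data.List.Relation.Unary.All using (All)
open import Data.Product using (∃; _×_)
open import Relation.Binary.PropositionalEquality using (_≢_)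
open import Relation.Unary using (Pred)

-- Convention: ℕ = {1,2,3,...} (positive integers), as is standard in this
-- area. A subset of ℕ is a predicate A on Agda's ℕ all of whose elements
-- are ≥ 1; finite subsets H ⊆ ℕ are lists of positive numbers; shifts and
-- dilations x range over positive integers.

Positive : Pred ℕ 0ℓ
Positive n = n ≥ 1

SubsetOfPos : Pred ℕ 0ℓ → Set
SubsetOfPos A = ∀ n → A n → Positive n

AdditivelyThick : Pred ℕ 0ℓ → Set
AdditivelyThick A =
  (H : List ℕ) → All Positive H →
  ∃ λ x → Positive x × All (λ h → A (h + x)) H

MultiplicativelyThick : Pred ℕ 0ℓ → Set
MultiplicativelyThick A =
  (H : List ℕ) → All Positive H →
  ∃ λ x → Positive x × All (λ h → A (h * x)) H

ContainsExpTriple : Pred ℕ 0ℓ → Set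
ContainsExpTriple A = ∃ λ x → ∃ λ y → A x × A y × x ≢ y × A (x ^ y)

{-# OPTIONS --safe #-}
module Submission where

-- Let t₀ = 4 and tₖ₊₁ = (tₖ²)^(tₖ²), and let A be the union of the blocks [tₖ, tₖ²).
-- A block [b, b²) contains h + b and h·b for every 0 < h < b, which gives both kinds
-- of thickness. If x and y lie in A, let c = tₖ² for the larger of their two blocks.
-- Then x, y < c, so x^y < c^c = tₖ₊₁; and x^y ≥ c, since either y ≥ tₖ and
-- x^y ≥ 4^y > y², or x ≥ tₖ and x^y ≥ x². So x^y falls into the gap [tₖ², tₖ₊₁).

open import Defs
open import Level using (0ℓ)
open import Data.Nat using (ℕ; zero; suc; _+_; _*_; _^_; _≤_; _<_; _≤′_; ≤′-refl; ≤′-step; z≤n; s≤s; z<s; _≤?_; NonZero; >-nonZero)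
open import Data.Nat.Properties
open import Data.List.Extrema.Nat using (max; xs≤max)
open import Data.List.Relation.Unary.All as All using (All)
open import Data.Product using (∃; _×_; _,_)
open import Data.Sum using ([_,_]′)
open import Relation.Nullary using (¬_; yes; no)
open import Relation.Unary using (Pred)
open import Relation.Binary.PropositionalEquality using (_≡_; refl; sym; trans; cong)

n≤n*n : ∀ n → n ≤ n * n
n≤n*n zero    = z≤n
n≤n*n (suc n) = m≤m*n (suc n) (suc n)

n<n*n : ∀ {n} → 1 < n → n < n * n
n<n*n 1<n@(s≤s _) = m<m*n _ _ 1<n

n≤n^n : ∀ n → n ≤ n ^ n
n≤n^n zero    = z≤n
n≤n^n (suc n) = m≤m*n (suc n) (suc n ^ n) {{m^n≢0 (suc n) n}}

n<2^n : ∀ n → n < 2 ^ n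
n<2^n zero    = z<s
n<2^n (suc n) = +-mono-≤ (m^n>0 2 n) (≤-trans (n<2^n n) (m≤m+n (2 ^ n) 0))

^-distribʳ-* : ∀ m n k → (m * n) ^ k ≡ m ^ k * n ^ k
^-distribʳ-* m n zero    = refl
^-distribʳ-* m n (suc k) = trans (cong (m * n *_) (^-distribʳ-* m n k))
                                 ([m*n]*[o*p]≡[m*o]*[n*p] m n (m ^ k) (n ^ k))

n*n<4^n : ∀ n → n * n < 4 ^ n
n*n<4^n n = <-≤-trans (*-mono-< (n<2^n n) (n<2^n n)) (≤-reflexive (sym (^-distribʳ-* 2 2 n)))

m*m≤m^n : ∀ m {n} .{{_ : NonZero m}} → 2 ≤ n → m * m ≤ m ^ n
m*m≤m^n m 2≤n = ≤-trans (≤-reflexive (cong (m *_) (sym (*-identityʳ m)))) (^-monoʳ-≤ m 2≤n)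

m^n<o^o : ∀ {m n o} .{{_ : NonZero m}} → m < o → n ≤ o → m ^ n < o ^ o
m^n<o^o {m} {n} {o} m<o@(s≤s _) n≤o = ≤-<-trans (^-monoʳ-≤ m {n} {o} n≤o) (^-monoˡ-< o m<o)

InBlock : ℕ → Pred ℕ 0ℓ
InBlock b z = b ≤ z × z < b * b

+-inBlock : ∀ {b h} → 2 ≤ b → h < b → InBlock b (h + b)
+-inBlock {b} {h} 2≤b h<b =
  m≤n+m b h , <-≤-trans (+-mono-<-≤ h<b (m≤m+n b 0)) (*-monoˡ-≤ b 2≤b)

*-inBlock : ∀ {b h} → 1 ≤ h → h < b → InBlock b (h * b)
*-inBlock {b} {h} 1≤h h<b =
  m≤n*m b h {{>-nonZero 1≤h}} , *-monoˡ-< b {{>-nonZero (m<n⇒0<n h<b)}} h<b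

tower : ℕ → ℕ
tower zero    = 4
tower (suc k) = (tower k * tower k) ^ (tower k * tower k)

tower-square≤tower-suc : ∀ k → tower k * tower k ≤ tower (suc k)
tower-square≤tower-suc k = n≤n^n (tower k * tower k)

tower-mono-≤′ : ∀ {k l} → k ≤′ l → tower k ≤ tower l
tower-mono-≤′ ≤′-refl           = ≤-refl
tower-mono-≤′ (≤′-step {l} k≤l) =
  ≤-trans (tower-mono-≤′ k≤l) (≤-trans (n≤n*n (tower l)) (tower-square≤tower-suc l))

tower-mono-≤ : ∀ {k l} → k ≤ l → tower k ≤ tower l
tower-mono-≤ k≤l = tower-mono-≤′ (≤⇒≤′ k≤l)

tower-square-mono-≤ : ∀ {k l} → k ≤ l → tower k * tower k ≤ tower l * tower l
tower-square-mono-≤ k≤l = *-mono-≤ (tower-mono-≤ k≤l) (tower-mono-≤ k≤l)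

4≤tower : ∀ k → 4 ≤ tower k
4≤tower k = tower-mono-≤ {0} {k} z≤n

2≤tower : ∀ k → 2 ≤ tower k
2≤tower k = ≤-trans (s≤s (s≤s z≤n)) (4≤tower k)

0<tower : ∀ k → 0 < tower k
0<tower k = ≤-trans (s≤s z≤n) (2≤tower k)

tower≤⇒nonZero : ∀ k {z} → tower k ≤ z → NonZero z
tower≤⇒nonZero k tₖ≤z = >-nonZero (<-≤-trans (0<tower k) tₖ≤z)

n<tower : ∀ n → n < tower n
n<tower zero    = z<s
n<tower (suc n) = ≤-<-trans (n<tower n)
  (<-≤-trans (n<n*n (2≤tower n)) (tower-square≤tower-suc n))

TowerBlocks : Pred ℕ 0ℓ
TowerBlocks z = ∃ λ k → InBlock (tower k) z

InGap : ℕ → Pred ℕ 0ℓ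
InGap k z = tower k * tower k ≤ z × z < tower (suc k)

inGap⇒∉towerBlocks : ∀ k {z} → InGap k z → ¬ TowerBlocks z
inGap⇒∉towerBlocks k (k²≤z , z<tₖ₊₁) (l , tₗ≤z , z<l²) with l ≤? k
... | yes l≤k = <⇒≱ z<l² (≤-trans (tower-square-mono-≤ l≤k) k²≤z)
... | no  l≰k = <⇒≱ z<tₖ₊₁ (≤-trans (tower-mono-≤ (≰⇒> l≰k)) tₗ≤z)

^-inGap : ∀ i j {x y} → InBlock (tower i) x → InBlock (tower j) y → ∃ λ k → InGap k (x ^ y)
^-inGap i j {x} {y} (tᵢ≤x , x<tᵢ²) (tⱼ≤y , y<tⱼ²) =
  [ (λ i≤j → j , inGapⱼ i≤j) , (λ j≤i → i , inGapᵢ j≤i) ]′ (≤-total i j)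
  where
  instance
    x≢0 : NonZero x
    x≢0 = tower≤⇒nonZero i tᵢ≤x

  inGapⱼ : i ≤ j → InGap j (x ^ y)
  inGapⱼ i≤j = lower , m^n<o^o (<-≤-trans x<tᵢ² (tower-square-mono-≤ i≤j)) (<⇒≤ y<tⱼ²)
    where
    open ≤-Reasoning
    lower : tower j * tower j ≤ x ^ y
    lower = begin
      tower j * tower j ≤⟨ *-mono-≤ tⱼ≤y tⱼ≤y ⟩
      y * y             <⟨ n*n<4^n y ⟩
      4 ^ y             ≤⟨ ^-monoˡ-≤ y (≤-trans (4≤tower i) tᵢ≤x) ⟩
      x ^ y             ∎

  inGapᵢ : j ≤ i → InGap i (x ^ y)
  inGapᵢ j≤i = lower , m^n<o^o x<tᵢ² (<⇒≤ (<-≤-trans y<tⱼ² (tower-square-mono-≤ j≤i)))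
    where
    lower : tower i * tower i ≤ x ^ y
    lower = ≤-trans (*-mono-≤ tᵢ≤x tᵢ≤x) (m*m≤m^n x (≤-trans (2≤tower j) tⱼ≤y))

towerBlocks-noExpTriple : ¬ ContainsExpTriple TowerBlocks
towerBlocks-noExpTriple (_ , _ , (i , x∈) , (j , y∈) , _ , xʸ∈) =
  let k , xʸ∈gap = ^-inGap i j x∈ y∈ in inGap⇒∉towerBlocks k xʸ∈gap xʸ∈

towerBlocks-positive : SubsetOfPos TowerBlocks
towerBlocks-positive z (k , tₖ≤z , _) = <-≤-trans (0<tower k) tₖ≤z

all<tower-max : ∀ H → All (_< tower (max 0 H)) H
all<tower-max H = All.map (λ h≤max → ≤-<-trans h≤max (n<tower (max 0 H))) (xs≤max 0 H)

towerBlocks-additivelyThick : AdditivelyThick TowerBlocks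
towerBlocks-additivelyThick H _ =
  tower k , 0<tower k , All.map (λ h<tₖ → k , +-inBlock (2≤tower k) h<tₖ) (all<tower-max H)
  where
  k : ℕ
  k = max 0 H

towerBlocks-multiplicativelyThick : MultiplicativelyThick TowerBlocks
towerBlocks-multiplicativelyThick H H-pos =
  tower k , 0<tower k , All.zipWith (λ (1≤h , h<tₖ) → k , *-inBlock 1≤h h<tₖ) (H-pos , all<tower-max H)
  where
  k : ℕ
  k = max 0 H

theorem5p1 : ∃ λ (A : Pred ℕ 0ℓ) → SubsetOfPos A × AdditivelyThick A × MultiplicativelyThick A × ¬ ContainsExpTriple A
theorem5p1 =
  TowerBlocks , towerBlocks-positive , towerBlocks-additivelyThick
              , towerBlocks-multiplicativelyThick , towerBlocks-noExpTriple
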